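{- Let $G=(V,E)$ be an undirected graph with edges $E=\{e_1,e_2,\dots,e_m\}$ and weight function $w$ with $w(e_1)<w(e_2)<\dots<w(e_m)$. Let $D$ be the diameter of the minimum spanning forest of $G$. Then for every $i\in[m]$, the graph $G'=(V,\{e_1,\dots,e_i\})$ has diameter at most $D$.
   Context: The diameter of a graph is the largest diameter of its connected components, i.e. the maximum of $\mathrm{dist}(u,v)$ (number of edges on a shortest path) over pairs $u,v$ in the same component. Since weights are distinct, the minimum spanning forest (spanning forest of minimum total weight) is unique.
   Formalization: The edge weights are rational. -}

module Defs where

open import Data.Nat using (ℕ; zero; suc; _≤_; _<_)
open import Data.Fin using (Fin; toℕ)
import Data.Fin as F
open import Data.Bool using (Bool; true; false; if_then_else_)
open import Data.Product using (_×_; _,_; proj₁; proj₂; Σ; ∃; ∃-syntax)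
open import Data.Sum using (_⊎_)
open import Relation.Binary.PropositionalEquality using (_≡_; _≢_)
open import Relation.Nullary using (¬_)
open import Data.Rational using (ℚ; 0ℚ; _+_) renaming (_≤_ to _≤ℚ_; _<_ to _<ℚ_)

-- A graph on vertex set Fin n with m edges; edge j has endpoints ends j.
-- An edge subset (spanning subgraph) is a predicate S : Fin m → Bool.
EdgeSet : ℕ → Set
EdgeSet m = Fin m → Bool

Joins : ∀ {n} → Fin n × Fin n → Fin n → Fin n → Set
Joins (a , b) u v = (a ≡ u × b ≡ v) ⊎ (a ≡ v × b ≡ u)

data Walk {n m : ℕ} (ends : Fin m → Fin n × Fin n) (S : EdgeSet m)
          : Fin n → Fin n → ℕ → Set where
  nil  : ∀ {u} → Walk ends S u u zero
  step : ∀ {u x v k} (j : Fin m) → S j ≡ true → Joins (ends j) u x →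
         Walk ends S x v k → Walk ends S u v (suc k)

Connected : ∀ {n m} → (Fin m → Fin n × Fin n) → EdgeSet m → Fin n → Fin n → Set
Connected ends S u v = ∃[ k ] Walk ends S u v k

DistAtMost : ∀ {n m} → (Fin m → Fin n × Fin n) → EdgeSet m → Fin n → Fin n → ℕ → Set
DistAtMost ends S u v d = ∃[ k ] (k ≤ d × Walk ends S u v k)

DistIs : ∀ {n m} → (Fin m → Fin n × Fin n) → EdgeSet m → Fin n → Fin n → ℕ → Set
DistIs ends S u v d = Walk ends S u v d × (∀ k → k < d → ¬ Walk ends S u v k)

DiamAtMost : ∀ {n m} → (Fin m → Fin n × Fin n) → EdgeSet m → ℕ → Set
DiamAtMost ends S D = ∀ u v → Connected ends S u v → DistAtMost ends S u v D

HasDiameter : ∀ {n m} → (Fin m → Fin n × Fin n) → EdgeSet m → ℕ → Set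
HasDiameter ends S D = DiamAtMost ends S D × ∃[ u ] ∃[ v ] DistIs ends S u v D

_⊆E_ : ∀ {m} → EdgeSet m → EdgeSet m → Set
S ⊆E T = ∀ j → S j ≡ true → T j ≡ true

remove : ∀ {m} → EdgeSet m → Fin m → EdgeSet m
remove S j i with i F.≟ j
... | Relation.Nullary.yes _ = false
... | Relation.Nullary.no  _ = S i

-- acyclic: no edge of S lies on a cycle, i.e. for every edge of S its
-- endpoints are not connected in S minus that edge
Acyclic : ∀ {n m} → (Fin m → Fin n × Fin n) → EdgeSet m → Set
Acyclic ends S = ∀ j → S j ≡ true →
  ¬ Connected ends (remove S j) (proj₁ (ends j)) (proj₂ (ends j))

allE : ∀ {m} → EdgeSet m
allE _ = true

IsSpanningForest : ∀ {n m} → (Fin m → Fin n × Fin n) → EdgeSet m → Set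
IsSpanningForest ends F = Acyclic ends F ×
  (∀ u v → Connected ends allE u v → Connected ends F u v)

weight : ∀ {m} → (Fin m → ℚ) → EdgeSet m → ℚ
weight {zero}  w S = 0ℚ
weight {suc m} w S =
  (if S F.zero then w F.zero else 0ℚ) + weight (λ i → w (F.suc i)) (λ i → S (F.suc i))

IsMinSpanningForest : ∀ {n m} → (Fin m → Fin n × Fin n) → (Fin m → ℚ) → EdgeSet m → Set
IsMinSpanningForest ends w F = IsSpanningForest ends F ×
  (∀ F′ → IsSpanningForest ends F′ → weight w F ≤ℚ weight w F′)

-- the edge set {e_1, …, e_i}  (edges with 0-based index < i)
prefix : ∀ {m} → ℕ → EdgeSet m
prefix i j with toℕ j Data.Nat.<? i
... | Relation.Nullary.yes _ = true
... | Relation.Nullary.no  _ = false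

IsSimple : ∀ {n m} → (Fin m → Fin n × Fin n) → Set
IsSimple ends = (∀ j → proj₁ (ends j) ≢ proj₂ (ends j)) ×
  (∀ i j → i ≢ j → ¬ Joins (ends i) (proj₁ (ends j)) (proj₂ (ends j)))

StrictlyIncreasing : ∀ {m} → (Fin m → ℚ) → Set
StrictlyIncreasing w = ∀ i j → toℕ i < toℕ j → w i <ℚ w j

-- Let F be the minimum spanning forest and S_i = F ∩ {e_1,…,e_i} the forest
-- edges among the i lightest edges.  The proof rests on two facts.
--
--  * Bridge lemma.  If S = T ∪ {k} and k joins two T-components, then every
--    S-walk between T-connected vertices can be replaced by a T-walk that is
--    no longer (the walk crosses k and must cross it back).
--  * Cycle property.  A non-forest edge e cannot be cheaper than a forest
--    edge k lying on the forest path between its ends, since F − k + e would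
--    be a lighter spanning forest.
--
-- Going down from S_m = F to S_i one edge at a time, the bridge lemma and the
-- cycle property show that the ends of every edge e_j with j ≤ i are already
-- connected in S_i, so the components of the prefix graph are those of S_i.
-- Hence for u, v in one component of the prefix graph, a walk of length ≤ D
-- in F shortens (again by the bridge lemma, edge by edge) to a walk of length
-- ≤ D in S_i ⊆ {e_1,…,e_i}.
module Submission where

open import Defs
open import Data.Nat using (ℕ; zero; suc; _+_; _≤_; _<_; _<?_; _≤′_; z≤n; s≤s; ≤′-refl; ≤′-step)
import Data.Nat.Properties as ℕ
open import Data.Fin using (Fin; toℕ; fromℕ<)
import Data.Fin as F
import Data.Fin.Properties as FinP
open import Data.Bool using (true; false; _∧_; if_then_else_)
open import Data.Product using (_×_; _,_; proj₁; proj₂; ∃-syntax)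
open import Data.Sum using (_⊎_; inj₁; inj₂)
open import Data.Empty using (⊥; ⊥-elim)
open import Relation.Binary.PropositionalEquality
open import Relation.Nullary using (¬_; yes; no)
open import Data.Rational using (ℚ; 0ℚ) renaming (_+_ to _+ℚ_; _<_ to _<ℚ_)
import Data.Rational.Properties as ℚ

downwardInduction : (X : ℕ → Set) {i m : ℕ} →
  (∀ {j} → i ≤ j → j < m → X (suc j) → X j) → i ≤′ m → X m → X i
downwardInduction X next ≤′-refl x = x
downwardInduction X next (≤′-step i≤′n) x =
  downwardInduction X (λ i≤j j<n → next i≤j (ℕ.m<n⇒m<1+n j<n)) i≤′n
    (next (ℕ.≤′⇒≤ i≤′n) (ℕ.n<1+n _) x)

false≢true : false ≢ true
false≢true ()

_∩_ : ∀ {m} → EdgeSet m → EdgeSet m → EdgeSet m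
(S ∩ T) j = S j ∧ T j

∩-intro : ∀ {m} (S T : EdgeSet m) {j} → S j ≡ true → T j ≡ true → (S ∩ T) j ≡ true
∩-intro S T Sj Tj rewrite Sj | Tj = refl

∩-left : ∀ {m} (S T : EdgeSet m) → (S ∩ T) ⊆E S
∩-left S T j p with S j
... | true  = refl
... | false = p

∩-right : ∀ {m} (S T : EdgeSet m) → (S ∩ T) ⊆E T
∩-right S T j p with S j
... | true  = p
... | false = ⊥-elim (false≢true p)

insert : ∀ {m} → EdgeSet m → Fin m → EdgeSet m
insert S j i with i F.≟ j
... | yes _ = true
... | no  _ = S i

insert-self : ∀ {m} (S : EdgeSet m) j → insert S j j ≡ true
insert-self S j with j F.≟ j
... | yes _ = refl
... | no j≢j = ⊥-elim (j≢j refl)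

insert-other : ∀ {m} (S : EdgeSet m) j i → i ≢ j → insert S j i ≡ S i
insert-other S j i i≢j with i F.≟ j
... | yes i≡j = ⊥-elim (i≢j i≡j)
... | no  _   = refl

insert-⊇ : ∀ {m} (S : EdgeSet m) j → S ⊆E insert S j
insert-⊇ S j i p with i F.≟ j
... | yes _ = refl
... | no  _ = p

remove-intro : ∀ {m} (S : EdgeSet m) j i → S i ≡ true → i ≢ j → remove S j i ≡ true
remove-intro S j i p i≢j with i F.≟ j
... | yes i≡j = ⊥-elim (i≢j i≡j)
... | no  _   = p

remove-⊆ : ∀ {m} (S : EdgeSet m) j → remove S j ⊆E S
remove-⊆ S j i p with i F.≟ j
... | yes _ = ⊥-elim (false≢true p)
... | no  _ = p

remove-≢ : ∀ {m} (S : EdgeSet m) j i → remove S j i ≡ true → i ≢ j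
remove-≢ S j i p with i F.≟ j
... | yes _   = ⊥-elim (false≢true p)
... | no  i≢j = i≢j

remove-other : ∀ {m} (S : EdgeSet m) j i → i ≢ j → remove S j i ≡ S i
remove-other S j i i≢j with i F.≟ j
... | yes i≡j = ⊥-elim (i≢j i≡j)
... | no  _   = refl

remove-self : ∀ {m} (S : EdgeSet m) j → remove S j j ≡ false
remove-self S j with j F.≟ j
... | yes _ = refl
... | no j≢j = ⊥-elim (j≢j refl)

insert-remove-other : ∀ {m} (S : EdgeSet m) j k i → i ≢ k →
  insert (remove S k) j i ≡ insert S j i
insert-remove-other S j k i i≢k with i F.≟ j
... | yes _ = refl
... | no  _ = remove-other S k i i≢k

prefix-intro : ∀ {m} i (j : Fin m) → toℕ j < i → prefix i j ≡ true
prefix-intro i j j<i with toℕ j <? i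
... | yes _   = refl
... | no  j≮i = ⊥-elim (j≮i j<i)

prefix-elim : ∀ {m} i (j : Fin m) → prefix i j ≡ true → toℕ j < i
prefix-elim i j p with toℕ j <? i
... | yes j<i = j<i
... | no  _   = ⊥-elim (false≢true p)

weight-ext : ∀ {m} (w : Fin m → ℚ) (S S′ : EdgeSet m) →
  (∀ y → S y ≡ S′ y) → weight w S ≡ weight w S′
weight-ext {zero}  w S S′ S≗S′ = refl
weight-ext {suc m} w S S′ S≗S′ =
  cong₂ _+ℚ_ (cong (λ b → if b then w F.zero else 0ℚ) (S≗S′ F.zero))
             (weight-ext (λ i → w (F.suc i)) _ _ (λ y → S≗S′ (F.suc y)))

weight-add-edge : ∀ {m} (w : Fin m → ℚ) (S S′ : EdgeSet m) (x : Fin m) →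
  S x ≡ false → S′ x ≡ true → (∀ y → y ≢ x → S′ y ≡ S y) →
  weight w S′ ≡ w x +ℚ weight w S
weight-add-edge {suc m} w S S′ F.zero Sx S′x agree rewrite Sx | S′x =
  cong (w F.zero +ℚ_)
    (trans (weight-ext _ _ _ (λ y → agree (F.suc y) (λ ())))
           (sym (ℚ.+-identityˡ _)))
weight-add-edge {suc m} w S S′ (F.suc x) Sx S′x agree = begin
  head S′ +ℚ weight w′ (tail S′)  ≡⟨ cong₂ _+ℚ_ (cong (λ b → if b then w F.zero else 0ℚ) (agree F.zero (λ ())))
                                                 (weight-add-edge w′ (tail S) (tail S′) x Sx S′x agree′) ⟩
  head S +ℚ (w′ x +ℚ rest)        ≡⟨ sym (ℚ.+-assoc (head S) (w′ x) rest) ⟩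
  (head S +ℚ w′ x) +ℚ rest        ≡⟨ cong (_+ℚ rest) (ℚ.+-comm (head S) (w′ x)) ⟩
  (w′ x +ℚ head S) +ℚ rest        ≡⟨ ℚ.+-assoc (w′ x) (head S) rest ⟩
  w′ x +ℚ (head S +ℚ rest)        ∎
  where
  open ≡-Reasoning
  w′ : Fin m → ℚ
  w′ i = w (F.suc i)
  head : EdgeSet (suc m) → ℚ
  head T = if T F.zero then w F.zero else 0ℚ
  tail : EdgeSet (suc m) → EdgeSet m
  tail T i = T (F.suc i)
  rest : ℚ
  rest = weight w′ (tail S)
  agree′ : ∀ y → y ≢ x → tail S′ y ≡ tail S y
  agree′ y y≢x = agree (F.suc y) (λ eq → y≢x (FinP.suc-injective eq))

module Graph {n m : ℕ} (ends : Fin m → Fin n × Fin n) where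

  Conn : EdgeSet m → Fin n → Fin n → Set
  Conn = Connected ends

  Linked : EdgeSet m → Fin m → Set
  Linked S j = Conn S (proj₁ (ends j)) (proj₂ (ends j))

  ShortWalk : EdgeSet m → Fin n → Fin n → ℕ → Set
  ShortWalk T x v L = ∃[ L′ ] (L′ ≤ L × Walk ends T x v L′)

  walk-mono : ∀ {S T} → S ⊆E T → ∀ {u v k} → Walk ends S u v k → Walk ends T u v k
  walk-mono S⊆T nil            = nil
  walk-mono S⊆T (step j p J w) = step j (S⊆T j p) J (walk-mono S⊆T w)

  lengthen : ∀ {T x v L} → ShortWalk T x v L → ShortWalk T x v (suc L)
  lengthen (L′ , L′≤L , w) = L′ , ℕ.m≤n⇒m≤1+n L′≤L , w

  conn-mono : ∀ {S T} → S ⊆E T → ∀ {u v} → Conn S u v → Conn T u v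
  conn-mono S⊆T (k , w) = k , walk-mono S⊆T w

  walk-++ : ∀ {S u x v k l} → Walk ends S u x k → Walk ends S x v l →
            Walk ends S u v (k + l)
  walk-++ nil            w′ = w′
  walk-++ (step j p J w) w′ = step j p J (walk-++ w w′)

  conn-refl : ∀ {S u} → Conn S u u
  conn-refl = 0 , nil

  conn-trans : ∀ {S u x v} → Conn S u x → Conn S x v → Conn S u v
  conn-trans (_ , w) (_ , w′) = _ , walk-++ w w′

  joins-sym : ∀ {p : Fin n × Fin n} {u v} → Joins p u v → Joins p v u
  joins-sym (inj₁ (a , b)) = inj₂ (a , b)
  joins-sym (inj₂ (a , b)) = inj₁ (a , b)

  conn-edge : ∀ {S u v} j → S j ≡ true → Joins (ends j) u v → Conn S u v
  conn-edge j p J = 1 , step j p J nil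

  walk-reverse-conn : ∀ {S u v k} → Walk ends S u v k → Conn S v u
  walk-reverse-conn nil            = conn-refl
  walk-reverse-conn (step j p J w) =
    conn-trans (walk-reverse-conn w) (conn-edge j p (joins-sym J))

  conn-sym : ∀ {S u v} → Conn S u v → Conn S v u
  conn-sym (_ , w) = walk-reverse-conn w

  linked-intro : ∀ {S} j {u v} → Joins (ends j) u v → Conn S u v → Linked S j
  linked-intro j (inj₁ (refl , refl)) c = c
  linked-intro j (inj₂ (refl , refl)) c = conn-sym c

  linked-elim : ∀ {S} j {u v} → Joins (ends j) u v → Linked S j → Conn S u v
  linked-elim j (inj₁ (refl , refl)) c = c
  linked-elim j (inj₂ (refl , refl)) c = conn-sym c

  conn-lift : ∀ {S T} → (∀ j → S j ≡ true → Linked T j) →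
              ∀ {u v k} → Walk ends S u v k → Conn T u v
  conn-lift link nil            = conn-refl
  conn-lift link (step j p J w) = conn-trans (linked-elim j J (link j p)) (conn-lift link w)

  -- A walk in S either avoids crossing k (giving
  -- a T-walk no longer than it) or ends on the far side of k.
  module Bridge (S T : EdgeSet m) (k : Fin m) (T⊆S : T ⊆E S)
                (S⊆T+k : ∀ y → S y ≡ true → y ≢ k → T y ≡ true)
                (bridge : S k ≡ true → ¬ Linked T k) where

    Crossing : Fin n → Fin n → ℕ → Set
    Crossing x v L = S k ≡ true × ∃[ a ] ∃[ b ]
      (Joins (ends k) a b × Conn T x a × ShortWalk T b v L)

    -- Crossing k from x to y and later from a to b returns to the T-component
    -- of x, since crossing twice in the same direction would link k in T.
    cross-back : ∀ {x y a b v L} → S k ≡ true → Joins (ends k) x y →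
                 Joins (ends k) a b → Conn T y a → Walk ends T b v L → Walk ends T x v L
    cross-back Sk (inj₁ (refl , refl)) (inj₁ (refl , refl)) c w = ⊥-elim (bridge Sk (conn-sym c))
    cross-back Sk (inj₁ (refl , refl)) (inj₂ (refl , refl)) c w = w
    cross-back Sk (inj₂ (refl , refl)) (inj₁ (refl , refl)) c w = w
    cross-back Sk (inj₂ (refl , refl)) (inj₂ (refl , refl)) c w = ⊥-elim (bridge Sk c)

    shortcut-or-cross : ∀ {x v L} → Walk ends S x v L → ShortWalk T x v L ⊎ Crossing x v L
    shortcut-or-cross nil = inj₁ (0 , z≤n , nil)
    shortcut-or-cross (step j p J w) with j F.≟ k | shortcut-or-cross w
    ... | no j≢k | inj₁ (L′ , L′≤ , w′) =
      inj₁ (suc L′ , s≤s L′≤ , step j (S⊆T+k j p j≢k) J w′)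
    ... | no j≢k | inj₂ (Sk , a , b , Jk , c , rest) =
      inj₂ (Sk , a , b , Jk , conn-trans (conn-edge j (S⊆T+k j p j≢k) J) c , lengthen rest)
    ... | yes refl | inj₁ rest = inj₂ (p , _ , _ , J , conn-refl , lengthen rest)
    ... | yes refl | inj₂ (Sk , a , b , Jk , c , L′ , L′≤ , w′) =
      inj₁ (L′ , ℕ.m≤n⇒m≤1+n L′≤ , cross-back Sk J Jk c w′)

    -- Between T-connected vertices the crossing case is impossible.
    shortcut : ∀ {x v L} → Walk ends S x v L → Conn T x v → ShortWalk T x v L
    shortcut w c with shortcut-or-cross w
    ... | inj₁ short = short
    ... | inj₂ (Sk , a , b , Jk , xa , _ , _ , bv) =
      ⊥-elim (bridge Sk (linked-intro k Jk
        (conn-trans (conn-sym xa) (conn-trans c (walk-reverse-conn bv)))))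

  acyclic-mono : ∀ {S T} → T ⊆E S → Acyclic ends S → Acyclic ends T
  acyclic-mono {S} {T} T⊆S acyc j Tj c =
    acyc j (T⊆S j Tj) (conn-mono (λ i p → remove-intro S j i (T⊆S i (remove-⊆ T j i p)) (remove-≢ T j i p)) c)

  acyclic-insert : ∀ {R} e → Acyclic ends R → ¬ Linked R e → Acyclic ends (insert R e)
  acyclic-insert {R} e acyc unlinked x x∈ with x F.≟ e
  ... | yes refl = λ c → unlinked (conn-mono without-e c)
    where
    without-e : remove (insert R e) e ⊆E R
    without-e y p = trans (sym (insert-other R e y (remove-≢ _ e y p))) (remove-⊆ _ e y p)
  ... | no x≢e = λ c → ends-of-x (shortcut-or-cross (proj₂ c))
    where
    Rx : R x ≡ true
    Rx = x∈
    T⊆S : remove R x ⊆E remove (insert R e) x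
    T⊆S y p = remove-intro _ x y (insert-⊇ R e y (remove-⊆ R x y p)) (remove-≢ R x y p)
    S⊆T+e : ∀ y → remove (insert R e) x y ≡ true → y ≢ e → remove R x y ≡ true
    S⊆T+e y p y≢e = remove-intro R x y
      (trans (sym (insert-other R e y y≢e)) (remove-⊆ _ x y p)) (remove-≢ _ x y p)
    open Bridge (remove (insert R e) x) (remove R x) e T⊆S S⊆T+e
                (λ _ c → unlinked (conn-mono (remove-⊆ R x) c))
    ends-of-x : ∀ {L} → ShortWalk (remove R x) _ _ L ⊎ Crossing _ _ L → ⊥
    ends-of-x (inj₁ (_ , _ , w)) = acyc x Rx (_ , w)
    ends-of-x (inj₂ (_ , a , b , Je , xa , _ , _ , bv)) =
      unlinked (linked-intro e Je (conn-trans (conn-sym (conn-mono (remove-⊆ R x) xa))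
        (conn-trans (conn-edge x Rx (inj₁ (refl , refl)))
                    (conn-mono (remove-⊆ R x) (walk-reverse-conn bv)))))

module MinimumSpanningForest {n m : ℕ} (ends : Fin m → Fin n × Fin n) (w : Fin m → ℚ)
                             (F : EdgeSet m) (msf : IsMinSpanningForest ends w F) where
  open Graph ends

  acyclic : Acyclic ends F
  acyclic = proj₁ (proj₁ msf)

  spanning : ∀ u v → Connected ends allE u v → Conn F u v
  spanning = proj₂ (proj₁ msf)

  exchange-weight : ∀ e k → F e ≡ false → F k ≡ true → k ≢ e →
    w e +ℚ weight w F ≡ w k +ℚ weight w (insert (remove F k) e)
  exchange-weight e k Fe Fk k≢e = begin
    w e +ℚ weight w F                         ≡⟨ sym (weight-add-edge w F (insert F e) e Fe (insert-self F e) (insert-other F e)) ⟩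
    weight w (insert F e)                     ≡⟨ weight-add-edge w F′ (insert F e) k F′k (trans (insert-other F e k k≢e) Fk)
                                                   (λ y y≢k → sym (insert-remove-other F e k y y≢k)) ⟩
    w k +ℚ weight w F′                        ∎
    where
    open ≡-Reasoning
    F′ : EdgeSet m
    F′ = insert (remove F k) e
    F′k : F′ k ≡ false
    F′k = trans (insert-other (remove F k) e k k≢e) (remove-self F k)

  -- Cycle property: a non-forest edge e is not lighter than any forest edge k
  -- on the forest path between its ends; otherwise F − k + e would be a
  -- lighter spanning forest.
  cycle-property : ∀ e k → F e ≡ false → F k ≡ true → w e <ℚ w k → ∀ {a b} →
    Joins (ends k) a b → Conn (remove F k) (proj₁ (ends e)) a →
    Conn (remove F k) b (proj₂ (ends e)) → ⊥
  cycle-property e k Fe Fk we<wk Jk ea be =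
    ℚ.<-irrefl (exchange-weight e k Fe Fk k≢e) lighter
    where
    k≢e : k ≢ e
    k≢e refl = false≢true (trans (sym Fe) Fk)
    R : EdgeSet m
    R = remove F k
    unlinked : ¬ Linked R e
    unlinked c = acyclic k Fk (linked-intro k Jk (conn-trans (conn-sym ea) (conn-trans c (conn-sym be))))
    relink : ∀ j → F j ≡ true → Linked (insert R e) j
    relink j Fj with j F.≟ k
    ... | yes refl = linked-intro k Jk (conn-trans (conn-sym (conn-mono (insert-⊇ R e) ea))
                       (conn-trans (conn-edge e (insert-self R e) (inj₁ (refl , refl)))
                                   (conn-sym (conn-mono (insert-⊇ R e) be))))
    ... | no j≢k = conn-edge j (insert-⊇ R e j (remove-intro F k j Fj j≢k)) (inj₁ (refl , refl))
    forest′ : IsSpanningForest ends (insert R e)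
    forest′ = acyclic-insert e (acyclic-mono (remove-⊆ F k) acyclic) unlinked
            , λ u v c → conn-lift relink (proj₂ (spanning u v c))
    lighter : w e +ℚ weight w F <ℚ w k +ℚ weight w (insert R e)
    lighter = ℚ.<-≤-trans (ℚ.+-monoˡ-< (weight w F) we<wk)
                          (ℚ.+-monoʳ-≤ (w k) (proj₂ msf (insert R e) forest′))

  forestPrefix : ℕ → EdgeSet m
  forestPrefix j = F ∩ prefix j

  forestPrefix-mono : ∀ {i j} → i ≤ j → forestPrefix i ⊆E forestPrefix j
  forestPrefix-mono {i} {j} i≤j y p = ∩-intro F (prefix j) (∩-left F (prefix i) y p)
    (prefix-intro j y (ℕ.<-≤-trans (prefix-elim i y (∩-right F (prefix i) y p)) i≤j))

  forest⊆forestPrefix : F ⊆E forestPrefix m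
  forest⊆forestPrefix y Fy = ∩-intro F (prefix m) Fy (prefix-intro m y (FinP.toℕ<n y))

  -- S_{j+1} is S_j plus possibly the edge e_{j+1}, whose ends S_j does not
  -- connect (S_j lies in F minus that edge): the bridge lemma applies.
  module BridgeStep (j : ℕ) (j<m : j < m) where
    k : Fin m
    k = fromℕ< j<m

    toℕ-k : toℕ k ≡ j
    toℕ-k = FinP.toℕ-fromℕ< j<m

    forestPrefix⊆F−k : forestPrefix j ⊆E remove F k
    forestPrefix⊆F−k y p = remove-intro F k y (∩-left F (prefix j) y p)
      (λ y≡k → ℕ.<-irrefl (trans (cong toℕ y≡k) toℕ-k) (prefix-elim j y (∩-right F (prefix j) y p)))

    grow : ∀ y → forestPrefix (suc j) y ≡ true → y ≢ k → forestPrefix j y ≡ true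
    grow y p y≢k = ∩-intro F (prefix j) (∩-left F (prefix (suc j)) y p) (prefix-intro j y
      (ℕ.≤∧≢⇒< (ℕ.≤-pred (prefix-elim (suc j) y (∩-right F (prefix (suc j)) y p)))
                (λ y≡j → y≢k (FinP.toℕ-injective (trans y≡j (sym toℕ-k))))))

    separated : forestPrefix (suc j) k ≡ true → ¬ Linked (forestPrefix j) k
    separated p c = acyclic k (∩-left F (prefix (suc j)) k p) (conn-mono forestPrefix⊆F−k c)

    open Bridge (forestPrefix (suc j)) (forestPrefix j) k
                (forestPrefix-mono (ℕ.n≤1+n j)) grow separated public

  module Prefixes (increasing : StrictlyIncreasing w) where

    nonforest-linked : ∀ e → F e ≡ false → Linked (forestPrefix (toℕ e)) e
    nonforest-linked e Fe =
      downwardInduction (λ j → Linked (forestPrefix j) e) drop (ℕ.≤⇒≤′ (ℕ.<⇒≤ (FinP.toℕ<n e)))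
        (conn-mono forest⊆forestPrefix (spanning _ _ (conn-edge e refl (inj₁ (refl , refl)))))
      where
      drop : ∀ {j} → toℕ e ≤ j → j < m → Linked (forestPrefix (suc j)) e → Linked (forestPrefix j) e
      drop {j} e≤j j<m (_ , walk) with BridgeStep.shortcut-or-cross j j<m walk
      ... | inj₁ (_ , _ , walk′) = _ , walk′
      ... | inj₂ (Sk , a , b , Jk , ea , _ , _ , be) =
        ⊥-elim (cycle-property e k Fe Fk (increasing e k e<k) Jk
                  (conn-mono forestPrefix⊆F−k ea) (conn-mono forestPrefix⊆F−k (_ , be)))
        where
        open BridgeStep j j<m
        Fk : F k ≡ true
        Fk = ∩-left F (prefix (suc j)) k Sk
        e<k : toℕ e < toℕ k
        e<k = subst (toℕ e <_) (sym toℕ-k) (ℕ.≤∧≢⇒< e≤j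
          (λ e≡j → false≢true (trans (sym Fe)
             (trans (cong F (FinP.toℕ-injective (trans e≡j (sym toℕ-k)))) Fk))))

    prefix-linked : ∀ i y → toℕ y < i → Linked (forestPrefix i) y
    prefix-linked i y y<i with F y in Fy
    ... | true  = conn-edge y (∩-intro F (prefix i) Fy (prefix-intro i y y<i)) (inj₁ (refl , refl))
    ... | false = conn-mono (forestPrefix-mono (ℕ.<⇒≤ y<i)) (nonforest-linked y Fy)

  shorten : ∀ {i u v L} → i ≤ m → Conn (forestPrefix i) u v →
            Walk ends F u v L → ShortWalk (forestPrefix i) u v L
  shorten {i} {u} {v} {L} i≤m uv walk =
    downwardInduction (λ j → ShortWalk (forestPrefix j) u v L) drop (ℕ.≤⇒≤′ i≤m)
      (L , ℕ.≤-refl , walk-mono forest⊆forestPrefix walk)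
    where
    drop : ∀ {j} → i ≤ j → j < m → ShortWalk (forestPrefix (suc j)) u v L → ShortWalk (forestPrefix j) u v L
    drop {j} i≤j j<m (L′ , L′≤L , walk′) with BridgeStep.shortcut j j<m walk′ (conn-mono (forestPrefix-mono i≤j) uv)
    ... | L″ , L″≤L′ , walk″ = L″ , ℕ.≤-trans L″≤L′ L′≤L , walk″

mainTheorem11 : (n m : ℕ) (ends : Fin m → Fin n × Fin n) (w : Fin m → ℚ) →
    IsSimple ends → StrictlyIncreasing w →
    (F : EdgeSet m) → IsMinSpanningForest ends w F →
    (D : ℕ) → HasDiameter ends F D →
    (i : ℕ) → 1 ≤ i → i ≤ m →
    DiamAtMost ends (prefix i) D
mainTheorem11 n m ends w _ increasing F msf D (diamF , _) i _ i≤m u v (_ , prefixWalk) =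
  viaForest (diamF u v (conn-mono (∩-left F (prefix i)) uvInSᵢ))
  where
  open Graph ends
  open MinimumSpanningForest ends w F msf
  open Prefixes increasing
  uvInSᵢ : Conn (forestPrefix i) u v
  uvInSᵢ = conn-lift (λ y p → prefix-linked i y (prefix-elim i y p)) prefixWalk
  viaForest : DistAtMost ends F u v D → DistAtMost ends (prefix i) u v D
  viaForest (L , L≤D , forestWalk) with shorten i≤m uvInSᵢ forestWalk
  ... | L′ , L′≤L , walk = L′ , ℕ.≤-trans L′≤L L≤D , walk-mono (∩-right F (prefix i)) walk
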